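{- Let $\Sigma_2$ be the signature with two sorts $\sigma_1,\sigma_2$ and no function or predicate symbols other than equality, and let ${\cal T}_{2,3}$ be the $\Sigma_2$-theory consisting of all $\Sigma_2$-structures ${\cal A}$ such that either ($|\sigma_1^{\cal A}|=2$ and $\sigma_2^{\cal A}$ is infinite) or ($|\sigma_1^{\cal A}|\ge 3$ and $|\sigma_2^{\cal A}|\ge 3$). Then ${\cal T}_{2,3}$ is smooth w.r.t. $\{\sigma_1,\sigma_2\}$.
   Context: Many-sorted first-order logic with equality; a ${\cal T}$-interpretation is an interpretation (structure plus values for variables) whose underlying structure is in ${\cal T}$. ${\cal T}$ is smooth w.r.t. a set $S$ of sorts if for every quantifier-free formula $\phi$, every ${\cal T}$-interpretation ${\cal A}$ satisfying $\phi$, and every function $\kappa$ from $S$ to cardinals with $\kappa(\sigma)\ge|\sigma^{\cal A}|$ for all $\sigma\in S$, there is a ${\cal T}$-interpretation ${\cal A}'$ satisfying $\phi$ with $|\sigma^{{\cal A}'}|=\kappa(\sigma)$ for all $\sigma\in S$. -}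

module Defs where

open import Level using (0ℓ)
open import Data.Nat using (ℕ)
open import Data.Fin using (Fin)
open import Data.Product using (Σ; ∃; _×_)
open import Data.Sum using (_⊎_)
open import Data.Unit using (⊤)
open import Data.Empty using (⊥)
open import Relation.Nullary using (¬_)
open import Relation.Binary.PropositionalEquality using (_≡_)
open import Function.Bundles using (_↣_; _⤖_)

data Sort : Set where
  σ₁ σ₂ : Sort

-- Variables: countably many of each sort, indexed by ℕ.
-- Terms are exactly variables (no function symbols), so atoms are x = y of one sort.
data QF : Set where
  tt ff : QF
  eq    : (s : Sort) → ℕ → ℕ → QF
  not   : QF → QF
  and   : QF → QF → QF
  or    : QF → QF → QF

-- A Σ₂-structure: one (possibly empty) carrier per sort; equality is interpreted
-- as identity (propositional equality).
record Structure : Set₁ where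
  field
    dom : Sort → Set

open Structure public

record Interpretation : Set₁ where
  field
    str : Structure
    val : (s : Sort) → ℕ → dom str s

open Interpretation public

_⊨_ : Interpretation → QF → Set
A ⊨ tt = ⊤
A ⊨ ff = ⊥
A ⊨ eq s x y = val A s x ≡ val A s y
A ⊨ not φ = ¬ (A ⊨ φ)
A ⊨ and φ ψ = (A ⊨ φ) × (A ⊨ ψ)
A ⊨ or φ ψ = (A ⊨ φ) ⊎ (A ⊨ ψ)

Theory : Set₂
Theory = Structure → Set₁

-- Cardinalities are represented by types: |A| ≤ |B| iff A ↣ B, |A| = |B| iff A ⤖ B.
Finite : Set → Set
Finite X = ∃ λ (n : ℕ) → X ⤖ Fin n

Infinite : Set → Set
Infinite X = ¬ Finite X

Smooth : Theory → (Sort → Set) → Set₁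
Smooth T S =
  (φ : QF) (A : Interpretation) → T (str A) → A ⊨ φ →
  (κ : Sort → Set) → ((σ : Sort) → S σ → dom (str A) σ ↣ κ σ) →
  Σ Interpretation λ A′ → T (str A′) × (A′ ⊨ φ) ×
    ((σ : Sort) → S σ → dom (str A′) σ ⤖ κ σ)

data T23 (A : Structure) : Set₁ where
  case2∞ : dom A σ₁ ⤖ Fin 2 → Infinite (dom A σ₂) → T23 A
  case33 : Fin 3 ↣ dom A σ₁ → Fin 3 ↣ dom A σ₂ → T23 A

AllSorts : Sort → Set
AllSorts _ = ⊤

-- Transport the interpretation along the given injections into the target
-- carriers: an injective renaming preserves and reflects every equality atom,
-- hence every quantifier-free formula.  It remains to see that enlarging the
-- carriers stays inside T₂,₃.  Lower bounds of three are kept and infinite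
-- sorts stay infinite.  If σ₁ had two elements, either its image misses a
-- point of the new σ₁ (which then has three elements, while the infinite σ₂
-- has three too) or it is onto (two elements again).  This case split and
-- "infinite sets contain every finite Fin n" are where excluded middle is used.
module Submission where

open import Defs
open import Level using (0ℓ)
open import Axiom.ExcludedMiddle using (ExcludedMiddle)
open import Data.Nat using (zero; suc)
open import Data.Nat.Properties using (n<1+n)
open import Data.Fin using (Fin; zero; suc)
open import Data.Fin.Properties using (any?; pigeonhole; <-irrefl)
open import Data.Product using (∃; _,_; proj₁; proj₂)
open import Data.Sum using (_⊎_; inj₁; inj₂)
open import Data.Unit using (tt)
open import Data.Empty using (⊥-elim)
open import Relation.Nullary using (yes; no)
open import Relation.Binary.PropositionalEquality using (_≡_; _≢_; refl; cong; sym)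
open import Function using (_∘_)
open import Function.Bundles using (_↣_; _⤖_; Injection; Bijection; mk↣; mk↔ₛ′)
open import Function.Construct.Composition using (_↣-∘_)
open import Function.Construct.Identity using (⤖-id)
open import Function.Construct.Symmetry using (⤖-sym)
open import Function.Properties.Inverse using (↔⇒⤖)

open Injection using (to; injective)

pushforward : (A : Interpretation) {κ : Sort → Set} →
              ((s : Sort) → dom (str A) s ↣ κ s) → Interpretation
pushforward A {κ} f = record
  { str = record { dom = κ }
  ; val = λ s x → to (f s) (val A s x)
  }

module _ (A : Interpretation) {κ : Sort → Set} (f : (s : Sort) → dom (str A) s ↣ κ s) where

  ⊨-pushforward⁺ : ∀ φ → A ⊨ φ → pushforward A f ⊨ φ
  ⊨-pushforward⁻ : ∀ φ → pushforward A f ⊨ φ → A ⊨ φ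

  ⊨-pushforward⁺ tt p = p
  ⊨-pushforward⁺ (eq s x y) p = cong (to (f s)) p
  ⊨-pushforward⁺ (not φ) p = λ q → p (⊨-pushforward⁻ φ q)
  ⊨-pushforward⁺ (and φ ψ) (p , q) = ⊨-pushforward⁺ φ p , ⊨-pushforward⁺ ψ q
  ⊨-pushforward⁺ (or φ ψ) (inj₁ p) = inj₁ (⊨-pushforward⁺ φ p)
  ⊨-pushforward⁺ (or φ ψ) (inj₂ p) = inj₂ (⊨-pushforward⁺ ψ p)

  ⊨-pushforward⁻ tt p = p
  ⊨-pushforward⁻ (eq s x y) p = injective (f s) p
  ⊨-pushforward⁻ (not φ) p = λ q → p (⊨-pushforward⁺ φ q)
  ⊨-pushforward⁻ (and φ ψ) (p , q) = ⊨-pushforward⁻ φ p , ⊨-pushforward⁻ ψ q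
  ⊨-pushforward⁻ (or φ ψ) (inj₁ p) = inj₁ (⊨-pushforward⁻ φ p)
  ⊨-pushforward⁻ (or φ ψ) (inj₂ p) = inj₂ (⊨-pushforward⁻ ψ p)

Fin↣⇒Infinite : ∀ {X : Set} → (∀ n → Fin n ↣ X) → Infinite X
Fin↣⇒Infinite g (m , b)
  with pigeonhole (n<1+n m) (λ i → Bijection.to b (to (g (suc m)) i))
... | i , j , i<j , bgi≡bgj =
  <-irrefl (injective (g (suc m)) (Bijection.injective b bgi≡bgj)) i<j

module _ (em : ExcludedMiddle 0ℓ) where

  ↣-extend-or-⤖ : ∀ {X : Set} {n} → Fin n ↣ X → (Fin (suc n) ↣ X) ⊎ (X ⤖ Fin n)
  ↣-extend-or-⤖ {X} {n} g with em {∃ λ (x : X) → ∀ i → to g i ≢ x}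
  ... | yes (x , x∉img) = inj₁ (mk↣ {to = cons} cons-injective)
    where
    cons : Fin (suc n) → X
    cons zero = x
    cons (suc i) = to g i
    cons-injective : ∀ {i j} → cons i ≡ cons j → i ≡ j
    cons-injective {zero} {zero} _ = refl
    cons-injective {zero} {suc j} e = ⊥-elim (x∉img j (sym e))
    cons-injective {suc i} {zero} e = ⊥-elim (x∉img i e)
    cons-injective {suc i} {suc j} e = cong suc (injective g e)
  ... | no surjective = inj₂ (↔⇒⤖ (mk↔ₛ′ (proj₁ ∘ preimage) (to g) preimage-to to-preimage))
    where
    preimage : (x : X) → ∃ λ i → to g i ≡ x
    preimage x with any? (λ i → em {to g i ≡ x})
    ... | yes hit = hit
    ... | no miss = ⊥-elim (surjective (x , λ i e → miss (i , e)))
    preimage-to : ∀ i → proj₁ (preimage (to g i)) ≡ i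
    preimage-to i = injective g (proj₂ (preimage (to g i)))
    to-preimage : ∀ x → to g (proj₁ (preimage x)) ≡ x
    to-preimage x = proj₂ (preimage x)

  Infinite⇒Fin↣ : ∀ {X : Set} → Infinite X → ∀ n → Fin n ↣ X
  Infinite⇒Fin↣ inf zero = mk↣ {to = λ ()} λ { {()} }
  Infinite⇒Fin↣ inf (suc n) with ↣-extend-or-⤖ (Infinite⇒Fin↣ inf n)
  ... | inj₁ g = g
  ... | inj₂ b = ⊥-elim (inf (n , b))

  Infinite-↣ : ∀ {X Y : Set} → X ↣ Y → Infinite X → Infinite Y
  Infinite-↣ f inf = Fin↣⇒Infinite (λ n → f ↣-∘ Infinite⇒Fin↣ inf n)

  T23-↣ : ∀ {A B : Structure} → ((s : Sort) → dom A s ↣ dom B s) → T23 A → T23 B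
  T23-↣ f (case33 three₁ three₂) = case33 (f σ₁ ↣-∘ three₁) (f σ₂ ↣-∘ three₂)
  T23-↣ f (case2∞ two inf)
    with ↣-extend-or-⤖ (f σ₁ ↣-∘ Bijection.injection (⤖-sym two))
  ... | inj₁ three₁ = case33 three₁ (f σ₂ ↣-∘ Infinite⇒Fin↣ inf 3)
  ... | inj₂ two′ = case2∞ two′ (Infinite-↣ (f σ₂) inf)

lemma1 : ExcludedMiddle 0ℓ → Smooth T23 AllSorts
lemma1 em φ A A∈T A⊨φ κ f =
  pushforward A f′ , T23-↣ em f′ A∈T , ⊨-pushforward⁺ A f′ φ A⊨φ , λ σ _ → ⤖-id (κ σ)
  where
  f′ : (s : Sort) → dom (str A) s ↣ κ s
  f′ s = f s tt
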